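{- Let $p$ be a prime, $\alpha\geqslant1$, and $X$ a multiset of elements of $\mathbb{Z}_{p^\alpha}$ in which every element has multiplicity at most $p-1$. Let $0\leqslant a\leqslant\alpha-1$ and suppose $(\mathcal{F}\Delta_X)(z)\equiv0\pmod{p^a}$ (in the ring $\mathbb{Z}[\zeta]$) for all $z\in\mathbb{Z}_{p^\alpha}$ with $\nu_p(z)\leqslant a$. Then there is a multiset $S$ of elements of $\mathbb{Z}_{p^{\alpha-a}}$ such that $X=\psi_{\alpha-a}^{ -1}(S)$; i.e. $X$ is a union of cosets of the subgroup $p^{\alpha-a}\mathbb{Z}_{p^\alpha}$.
   Context: $\Delta_X$ is the multiplicity function of $X$; $(\mathcal{F}\Delta_X)(z)=\sum_{i\in\mathbb{Z}_{p^\alpha}}\Delta_X(i)\zeta^{iz}$ with $\zeta$ a fixed primitive $p^\alpha$-th root of unity. $\nu_p(z)$ is the largest $j\leqslant\alpha$ with $p^j\mid z$. $\psi_{\gamma}:\mathbb{Z}_{p^\alpha}\to\mathbb{Z}_{p^\gamma}$ is reduction mod $p^\gamma$; for a multiset $S$ of $\mathbb{Z}_{p^\gamma}$, $\psi_\gamma^{ -1}(S)$ is the multiset in which each $i\in\mathbb{Z}_{p^\alpha}$ has multiplicity $\Delta_S(\psi_\gamma(i))$. -}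

module Defs where

open import Data.Nat using (ℕ; zero; suc; _*_; _^_; _∸_; _≤_; _%_; NonZero)
open import Data.Nat.Properties using (m^n≢0)
open import Data.Nat.DivMod using (m%n<n)
open import Data.Nat.Divisibility using (_∣_)
open import Data.Nat.Primality using (Prime; prime⇒nonZero)
open import Data.Integer using (ℤ; +_) renaming (_+_ to _+ℤ_; _*_ to _*ℤ_)
open import Data.Fin using (Fin; toℕ; fromℕ<)
open import Data.List using (List; []; _∷_; map; foldr; allFin; upTo; replicate; _++_)
open import Data.Product using (Σ; ∃)
open import Relation.Binary.PropositionalEquality using (_≡_)

-- Integer polynomials as coefficient lists (constant term first).

Poly : Set
Poly = List ℤ

coeff : Poly → ℕ → ℤ
coeff []      _       = + 0
coeff (c ∷ f) zero    = c
coeff (c ∷ f) (suc k) = coeff f k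

infixl 6 _⊕_
infixl 7 _⊛_

_⊕_ : Poly → Poly → Poly
[]      ⊕ g       = g
(c ∷ f) ⊕ []      = c ∷ f
(c ∷ f) ⊕ (d ∷ g) = (c +ℤ d) ∷ (f ⊕ g)

_⊛_ : Poly → Poly → Poly
[]      ⊛ g = []
(c ∷ f) ⊛ g = map (c *ℤ_) g ⊕ (+ 0 ∷ (f ⊛ g))

monomial : ℤ → ℕ → Poly
monomial c k = replicate k (+ 0) ++ (c ∷ [])

const : ℤ → Poly
const c = c ∷ []

_≈ₚ_ : Poly → Poly → Set
f ≈ₚ g = ∀ k → coeff f k ≡ coeff g k

-- ℤ[ζ] with ζ a primitive p^α-th root of unity, realised as
-- ℤ[x] / (Φ_{p^α}(x)),  Φ_{p^α}(x) = Σ_{j<p} x^{j·p^(α-1)}.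
-- An element of ℤ[ζ] is represented by a polynomial (ζ ↦ x).

cyclotomicPP : ℕ → ℕ → Poly
cyclotomicPP p α = foldr (λ j acc → monomial (+ 1) (j * p ^ (α ∸ 1)) ⊕ acc) [] (upTo p)

-- m divides (the element represented by) f in ℤ[ζ]:
-- there is g ∈ ℤ[ζ] with f = m·g in ℤ[ζ], i.e. f = m·g + Φ·h in ℤ[x].
DividesInℤζ : ℕ → ℕ → ℤ → Poly → Set
DividesInℤζ p α m f =
  Σ Poly λ g → Σ Poly λ h → f ≈ₚ (const m ⊛ g ⊕ cyclotomicPP p α ⊛ h)

-- Fourier transform of a multiplicity function Δ on ℤ_{p^α}:
-- (FΔ)(z) = Σ_i Δ(i) ζ^{i z}, as an element of ℤ[ζ].

fourier : (p α : ℕ) → (Fin (p ^ α) → ℕ) → Fin (p ^ α) → Poly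
fourier p α Δ z =
  foldr (λ i acc → monomial (+ (Δ i)) (toℕ i * toℕ z) ⊕ acc) [] (allFin (p ^ α))

-- ν_p(z) ≤ a, where ν_p(z) is the largest j ≤ α with p^j ∣ z.
νp≤ : (p α : ℕ) → Fin (p ^ α) → ℕ → Set
νp≤ p α z a = ∀ j → j ≤ α → p ^ j ∣ toℕ z → j ≤ a

ψ : (p : ℕ) → Prime p → (α γ : ℕ) → Fin (p ^ α) → Fin (p ^ γ)
ψ p pr α γ i =
  fromℕ< (m%n<n (toℕ i) (p ^ γ) {{m^n≢0 p γ {{prime⇒nonZero pr}}}})

-- Extend Δ to D : ℕ → ℕ with period p^α and assume D has period M = p^(α-j), j < a; put Q = M/p.
-- Pair F(p^j) = Σ_i Δ(i) x^(i p^j) with the linear functional that weighs the coefficients of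
-- x^(p^j m), m ≡ s·Q + r (mod M).  By periodicity this yields p^j·D(sQ + r).  On a multiple of
-- p^a it yields a multiple of p^(j+1), and on a multiple of Φ_{p^α}(x) = Σ_{t<p} x^(t p^(α-1)) it
-- yields a value independent of s, because adding t·p^(α-1) = p^j·tQ, t < p, to an exponent runs
-- m through every class s·Q + r (mod M) once.  So the values D(sQ + r), 0 ≤ s < p, agree modulo
-- p; lying in [0, p-1], they are equal, i.e. D has period Q.  After a such steps D has period
-- p^(α-a).
module Submission where

open import Defs
open import Data.Fin using (Fin; toℕ; fromℕ<)
import Data.Fin as Fin
open import Data.Fin.Properties using (toℕ-fromℕ<; toℕ-injective; toℕ<n)
open import Data.Integer using (ℤ; +_; ∣_∣; _⊖_)
  renaming (_+_ to _+ℤ_; _*_ to _*ℤ_; _-_ to _-ℤ_)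
import Data.Integer.Properties as ℤP
open import Algebra.Properties.AbelianGroup ℤP.+-0-abelianGroup
  using () renaming (∙-cancelˡ to +ℤ-cancelˡ)
open import Data.Integer.Tactic.RingSolver using (solve-∀)
open import Data.List using ([]; _∷_; map; foldr; applyUpTo; tabulate; upTo; allFin)
open import Data.Nat using (ℕ; zero; suc; _+_; _*_; _^_; _∸_; _≤_; _<_; _%_; _/_; z<s; s<s)
open import Data.Nat using (NonZero; >-nonZero; >-nonZero⁻¹; nonTrivial⇒n>1)
open import Data.Nat.DivMod
open import Data.Nat.Divisibility using (_∣_; n∣m*n; ∣⇒≤)
open import Data.Nat.Primality using (Prime; prime⇒nonZero; prime⇒nonTrivial)
open import Data.Nat.Properties
open import Data.Product using (Σ; _,_)
open import Function using (_∘_)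
open import Relation.Binary.PropositionalEquality

-- Linear functionals on ℤ[x]

⟪_,_⟫ : (ℕ → ℤ) → Poly → ℤ
⟪ w , []    ⟫ = + 0
⟪ w , c ∷ f ⟫ = w 0 *ℤ c +ℤ ⟪ w ∘ suc , f ⟫

⟪⟫-congˡ : ∀ {u v} → u ≗ v → ∀ f → ⟪ u , f ⟫ ≡ ⟪ v , f ⟫
⟪⟫-congˡ u≗v []      = refl
⟪⟫-congˡ u≗v (c ∷ f) = cong₂ _+ℤ_ (cong (_*ℤ c) (u≗v 0)) (⟪⟫-congˡ (u≗v ∘ suc) f)

⟪⟫-zeroˡ : ∀ f → ⟪ (λ _ → + 0) , f ⟫ ≡ + 0
⟪⟫-zeroˡ []      = refl
⟪⟫-zeroˡ (c ∷ f) = trans (ℤP.+-identityˡ _) (⟪⟫-zeroˡ f)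

⟪⟫-≈₀ : ∀ w f → f ≈ₚ [] → ⟪ w , f ⟫ ≡ + 0
⟪⟫-≈₀ w []      f≈0 = refl
⟪⟫-≈₀ w (c ∷ f) f≈0 = cong₂ _+ℤ_
  (trans (cong (w 0 *ℤ_) (f≈0 0)) (ℤP.*-zeroʳ (w 0))) (⟪⟫-≈₀ (w ∘ suc) f (f≈0 ∘ suc))

⟪⟫-≈ : ∀ w f g → f ≈ₚ g → ⟪ w , f ⟫ ≡ ⟪ w , g ⟫
⟪⟫-≈ w []      g       f≈g = sym (⟪⟫-≈₀ w g (sym ∘ f≈g))
⟪⟫-≈ w (c ∷ f) []      f≈g = ⟪⟫-≈₀ w (c ∷ f) f≈g
⟪⟫-≈ w (c ∷ f) (d ∷ g) f≈g =
  cong₂ _+ℤ_ (cong (w 0 *ℤ_) (f≈g 0)) (⟪⟫-≈ (w ∘ suc) f g (f≈g ∘ suc))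

⟪⟫-⊕ : ∀ w f g → ⟪ w , f ⊕ g ⟫ ≡ ⟪ w , f ⟫ +ℤ ⟪ w , g ⟫
⟪⟫-⊕ w []      g       = sym (ℤP.+-identityˡ _)
⟪⟫-⊕ w (c ∷ f) []      = sym (ℤP.+-identityʳ _)
⟪⟫-⊕ w (c ∷ f) (d ∷ g) =
  trans (cong (w 0 *ℤ (c +ℤ d) +ℤ_) (⟪⟫-⊕ (w ∘ suc) f g)) (interchange (w 0) c d _ _)
  where
  interchange : ∀ a c d x y → a *ℤ (c +ℤ d) +ℤ (x +ℤ y) ≡ (a *ℤ c +ℤ x) +ℤ (a *ℤ d +ℤ y)
  interchange = solve-∀

⟪⟫-map-* : ∀ w c g → ⟪ w , map (c *ℤ_) g ⟫ ≡ c *ℤ ⟪ w , g ⟫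
⟪⟫-map-* w c []      = sym (ℤP.*-zeroʳ c)
⟪⟫-map-* w c (d ∷ g) =
  trans (cong (w 0 *ℤ (c *ℤ d) +ℤ_) (⟪⟫-map-* (w ∘ suc) c g)) (factor (w 0) c d _)
  where
  factor : ∀ a c d x → a *ℤ (c *ℤ d) +ℤ c *ℤ x ≡ c *ℤ (a *ℤ d +ℤ x)
  factor = solve-∀

⟪⟫-+ˡ : ∀ u v f → ⟪ (λ n → u n +ℤ v n) , f ⟫ ≡ ⟪ u , f ⟫ +ℤ ⟪ v , f ⟫
⟪⟫-+ˡ u v []      = refl
⟪⟫-+ˡ u v (c ∷ f) =
  trans (cong ((u 0 +ℤ v 0) *ℤ c +ℤ_) (⟪⟫-+ˡ (u ∘ suc) (v ∘ suc) f)) (interchange (u 0) (v 0) c _ _)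
  where
  interchange : ∀ a b c x y → (a +ℤ b) *ℤ c +ℤ (x +ℤ y) ≡ (a *ℤ c +ℤ x) +ℤ (b *ℤ c +ℤ y)
  interchange = solve-∀

⟪⟫-*ˡ : ∀ u d f → ⟪ (λ n → u n *ℤ d) , f ⟫ ≡ d *ℤ ⟪ u , f ⟫
⟪⟫-*ˡ u d []      = sym (ℤP.*-zeroʳ d)
⟪⟫-*ˡ u d (c ∷ f) = trans (cong (u 0 *ℤ d *ℤ c +ℤ_) (⟪⟫-*ˡ (u ∘ suc) d f)) (factor (u 0) d c _)
  where
  factor : ∀ a d c x → a *ℤ d *ℤ c +ℤ d *ℤ x ≡ d *ℤ (a *ℤ c +ℤ x)
  factor = solve-∀

⟪⟫-const⊛ : ∀ w m g → ⟪ w , const m ⊛ g ⟫ ≡ m *ℤ ⟪ w , g ⟫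
⟪⟫-const⊛ w m g = begin
  ⟪ w , map (m *ℤ_) g ⊕ (+ 0 ∷ []) ⟫         ≡⟨ ⟪⟫-⊕ w (map (m *ℤ_) g) (+ 0 ∷ []) ⟩
  ⟪ w , map (m *ℤ_) g ⟫ +ℤ (w 0 *ℤ + 0 +ℤ + 0) ≡⟨ cong₂ _+ℤ_ (⟪⟫-map-* w m g) (ℤP.+-identityʳ _) ⟩
  m *ℤ ⟪ w , g ⟫ +ℤ w 0 *ℤ + 0                ≡⟨ cong (m *ℤ ⟪ w , g ⟫ +ℤ_) (ℤP.*-zeroʳ (w 0)) ⟩
  m *ℤ ⟪ w , g ⟫ +ℤ + 0                       ≡⟨ ℤP.+-identityʳ _ ⟩
  m *ℤ ⟪ w , g ⟫                              ∎
  where open ≡-Reasoning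

⟪⟫-⊛ : ∀ w F h → ⟪ w , F ⊛ h ⟫ ≡ ⟪ (λ n → ⟪ (λ k → w (n + k)) , F ⟫) , h ⟫
⟪⟫-⊛ w []      h = sym (⟪⟫-zeroˡ h)
⟪⟫-⊛ w (c ∷ F) h = begin
  ⟪ w , map (c *ℤ_) h ⊕ (+ 0 ∷ F ⊛ h) ⟫
    ≡⟨ ⟪⟫-⊕ w (map (c *ℤ_) h) _ ⟩
  ⟪ w , map (c *ℤ_) h ⟫ +ℤ (w 0 *ℤ + 0 +ℤ ⟪ w ∘ suc , F ⊛ h ⟫)
    ≡⟨ cong₂ _+ℤ_ (⟪⟫-map-* w c h)
         (cong₂ _+ℤ_ (ℤP.*-zeroʳ (w 0)) (⟪⟫-⊛ (w ∘ suc) F h)) ⟩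
  c *ℤ ⟪ w , h ⟫ +ℤ (+ 0 +ℤ ⟪ (λ n → ⟪ (λ k → w (suc (n + k))) , F ⟫) , h ⟫)
    ≡⟨ cong₂ _+ℤ_
         (cong (c *ℤ_) (⟪⟫-congˡ (λ n → cong w (sym (+-identityʳ n))) h))
         (trans (ℤP.+-identityˡ _)
           (⟪⟫-congˡ (λ n → ⟪⟫-congˡ (λ k → cong w (sym (+-suc n k))) F) h)) ⟩
  c *ℤ ⟪ (λ n → w (n + 0)) , h ⟫ +ℤ ⟪ (λ n → ⟪ (λ k → w (n + suc k)) , F ⟫) , h ⟫
    ≡⟨ cong (_+ℤ ⟪ (λ n → ⟪ (λ k → w (n + suc k)) , F ⟫) , h ⟫)
         (sym (⟪⟫-*ˡ (λ n → w (n + 0)) c h)) ⟩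
  ⟪ (λ n → w (n + 0) *ℤ c) , h ⟫ +ℤ ⟪ (λ n → ⟪ (λ k → w (n + suc k)) , F ⟫) , h ⟫
    ≡⟨ sym (⟪⟫-+ˡ (λ n → w (n + 0) *ℤ c) _ h) ⟩
  ⟪ (λ n → ⟪ (λ k → w (n + k)) , c ∷ F ⟫) , h ⟫
    ∎
  where open ≡-Reasoning

⟪⟫-monomial : ∀ w c e → ⟪ w , monomial c e ⟫ ≡ w e *ℤ c
⟪⟫-monomial w c zero    = ℤP.+-identityʳ _
⟪⟫-monomial w c (suc e) = trans (cong (_+ℤ ⟪ w ∘ suc , monomial c e ⟫) (ℤP.*-zeroʳ (w 0)))
  (trans (ℤP.+-identityˡ _) (⟪⟫-monomial (w ∘ suc) c e))

⟪⟫-∑monomial : ∀ {A : Set} w (c : A → ℤ) (e : A → ℕ) xs →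
  ⟪ w , foldr (λ x acc → monomial (c x) (e x) ⊕ acc) [] xs ⟫ ≡
  foldr (λ x acc → w (e x) *ℤ c x +ℤ acc) (+ 0) xs
⟪⟫-∑monomial w c e []       = refl
⟪⟫-∑monomial w c e (x ∷ xs) = trans (⟪⟫-⊕ w (monomial (c x) (e x)) _)
  (cong₂ _+ℤ_ (⟪⟫-monomial w (c x) (e x)) (⟪⟫-∑monomial w c e xs))

-- Finite sums over initial segments of ℕ

∑ : ℕ → (ℕ → ℤ) → ℤ
∑ zero    f = + 0
∑ (suc n) f = f 0 +ℤ ∑ n (f ∘ suc)

δ : ℕ → ℕ → ℤ
δ zero    zero    = + 1
δ zero    (suc _) = + 0
δ (suc _) zero    = + 0
δ (suc m) (suc n) = δ m n

Periodic : {A : Set} → ℕ → (ℕ → A) → Set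
Periodic M g = ∀ n → g (n + M) ≡ g n

∑-cong : ∀ n {f g} → (∀ t → t < n → f t ≡ g t) → ∑ n f ≡ ∑ n g
∑-cong zero    f≗g = refl
∑-cong (suc n) f≗g = cong₂ _+ℤ_ (f≗g 0 z<s) (∑-cong n (λ t t<n → f≗g (suc t) (s<s t<n)))

∑-zero : ∀ n → ∑ n (λ _ → + 0) ≡ + 0
∑-zero zero    = refl
∑-zero (suc n) = trans (ℤP.+-identityˡ _) (∑-zero n)

∑-*ˡ : ∀ n c f → ∑ n (λ t → c *ℤ f t) ≡ c *ℤ ∑ n f
∑-*ˡ zero    c f = sym (ℤP.*-zeroʳ c)
∑-*ˡ (suc n) c f =
  trans (cong (c *ℤ f 0 +ℤ_) (∑-*ˡ n c (f ∘ suc))) (sym (ℤP.*-distribˡ-+ c (f 0) _))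

∑-snoc : ∀ n f → ∑ (suc n) f ≡ ∑ n f +ℤ f n
∑-snoc zero    f = ℤP.+-comm (f 0) (+ 0)
∑-snoc (suc n) f = trans (cong (f 0 +ℤ_) (∑-snoc n (f ∘ suc))) (sym (ℤP.+-assoc (f 0) _ _))

∑-+ : ∀ m n f → ∑ (m + n) f ≡ ∑ m f +ℤ ∑ n (λ t → f (m + t))
∑-+ zero    n f = sym (ℤP.+-identityˡ _)
∑-+ (suc m) n f = trans (cong (f 0 +ℤ_) (∑-+ m n (f ∘ suc))) (sym (ℤP.+-assoc (f 0) _ _))

∑-* : ∀ k Q f → ∑ (k * Q) f ≡ ∑ k (λ σ → ∑ Q (λ ρ → f (σ * Q + ρ)))
∑-* zero    Q f = refl
∑-* (suc k) Q f = trans (∑-+ Q (k * Q) f) (cong (∑ Q f +ℤ_)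
  (trans (∑-* k Q (λ t → f (Q + t)))
    (∑-cong k (λ σ _ → ∑-cong Q (λ ρ _ → cong f (sym (+-assoc Q (σ * Q) ρ)))))))

∑-periodic : ∀ M {g} → Periodic M g → ∀ k → ∑ (k * M) g ≡ + k *ℤ ∑ M g
∑-periodic M {g} per zero    = refl
∑-periodic M {g} per (suc k) = begin
  ∑ (M + k * M) g                      ≡⟨ ∑-+ M (k * M) g ⟩
  ∑ M g +ℤ ∑ (k * M) (λ t → g (M + t)) ≡⟨ cong (∑ M g +ℤ_) (∑-cong (k * M) (λ t _ →
                                             trans (cong g (+-comm M t)) (per t))) ⟩
  ∑ M g +ℤ ∑ (k * M) g                 ≡⟨ cong (∑ M g +ℤ_) (∑-periodic M per k) ⟩
  ∑ M g +ℤ + k *ℤ ∑ M g                ≡⟨ sym (ℤP.suc-* (+ k) (∑ M g)) ⟩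
  + suc k *ℤ ∑ M g                     ∎
  where open ≡-Reasoning

∑-shift : ∀ n h → h n ≡ h 0 → ∑ n (h ∘ suc) ≡ ∑ n h
∑-shift n h hn≡h0 = +ℤ-cancelˡ (h 0) _ _ (begin
  ∑ (suc n) h    ≡⟨ ∑-snoc n h ⟩
  ∑ n h +ℤ h n   ≡⟨ cong (∑ n h +ℤ_) hn≡h0 ⟩
  ∑ n h +ℤ h 0   ≡⟨ ℤP.+-comm (∑ n h) (h 0) ⟩
  h 0 +ℤ ∑ n h   ∎)
  where open ≡-Reasoning

∑-window : ∀ n {g} → Periodic n g → ∀ q → ∑ n (λ t → g (q + t)) ≡ ∑ n g
∑-window n     per zero    = refl
∑-window n {g} per (suc q) = begin
  ∑ n (λ t → g (suc q + t)) ≡⟨ ∑-cong n (λ t _ → cong g (sym (+-suc q t))) ⟩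
  ∑ n (λ t → g (q + suc t)) ≡⟨ ∑-shift n (λ t → g (q + t))
                                  (trans (per q) (cong g (sym (+-identityʳ q)))) ⟩
  ∑ n (λ t → g (q + t))     ≡⟨ ∑-window n per q ⟩
  ∑ n g                     ∎
  where open ≡-Reasoning

∑-δ : ∀ n {r} (f : ℕ → ℤ) → r < n → ∑ n (λ t → δ t r *ℤ f t) ≡ f r
∑-δ (suc n) {zero}  f _ =
  trans (cong₂ _+ℤ_ (ℤP.*-identityˡ (f 0)) (∑-zero n)) (ℤP.+-identityʳ (f 0))
∑-δ (suc n) {suc r} f (s<s r<n) = trans (ℤP.+-identityˡ _) (∑-δ n (f ∘ suc) r<n)

∑-δ-% : ∀ p .{{_ : NonZero p}} {s} → s < p → ∀ q → ∑ p (λ t → δ ((q + t) % p) s) ≡ + 1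
∑-δ-% p {s} s<p q = begin
  ∑ p (λ t → δ ((q + t) % p) s)  ≡⟨ ∑-window p {λ m → δ (m % p) s}
                                       (λ n → cong (λ m → δ m s) ([m+n]%n≡m%n n p)) q ⟩
  ∑ p (λ t → δ (t % p) s)        ≡⟨ ∑-cong p (λ t t<p → trans (cong (λ m → δ m s) (m<n⇒m%n≡m t<p))
                                                            (sym (ℤP.*-identityʳ (δ t s)))) ⟩
  ∑ p (λ t → δ t s *ℤ + 1)       ≡⟨ ∑-δ p (λ _ → + 1) s<p ⟩
  + 1                            ∎
  where open ≡-Reasoning

∑-applyUpTo : ∀ (G : ℕ → ℤ) g n →
  foldr (λ x acc → G x +ℤ acc) (+ 0) (applyUpTo g n) ≡ ∑ n (G ∘ g)
∑-applyUpTo G g zero    = refl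
∑-applyUpTo G g (suc n) = cong (G (g 0) +ℤ_) (∑-applyUpTo G (g ∘ suc) n)

∑-tabulate : ∀ {A : Set} n (f : Fin n → A) (G : A → ℤ) (H : ℕ → ℤ) → (∀ i → G (f i) ≡ H (toℕ i)) →
  foldr (λ x acc → G x +ℤ acc) (+ 0) (tabulate f) ≡ ∑ n H
∑-tabulate zero    f G H G≗H = refl
∑-tabulate (suc n) f G H G≗H =
  cong₂ _+ℤ_ (G≗H Fin.zero) (∑-tabulate n (f ∘ Fin.suc) G (H ∘ suc) (G≗H ∘ Fin.suc))

⟪⟫-cyclotomic⊛ : ∀ p α w h →
  ⟪ w , cyclotomicPP p α ⊛ h ⟫ ≡ ⟪ (λ n → ∑ p (λ t → w (n + t * p ^ (α ∸ 1)))) , h ⟫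
⟪⟫-cyclotomic⊛ p α w h = trans (⟪⟫-⊛ w (cyclotomicPP p α) h) (⟪⟫-congˡ (λ n →
  trans (⟪⟫-∑monomial (λ k → w (n + k)) (λ _ → + 1) (λ t → t * p ^ (α ∸ 1)) (upTo p))
  (trans (∑-applyUpTo (λ t → w (n + t * p ^ (α ∸ 1)) *ℤ + 1) (λ t → t) p)
         (∑-cong p (λ t _ → ℤP.*-identityʳ _)))) h)

-- Periodic functions on ℕ

periodic-+* : ∀ {A : Set} {M} {g : ℕ → A} → Periodic M g → ∀ n k → g (n + k * M) ≡ g n
periodic-+* {g = g} per n zero    = cong g (+-identityʳ n)
periodic-+* {M = M} {g} per n (suc k) =
  trans (cong g (sym (+-assoc n M (k * M)))) (trans (periodic-+* per (n + M) k) (per n))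

periodic-% : ∀ {A : Set} {M} .{{_ : NonZero M}} {g : ℕ → A} → Periodic M g → ∀ n → g n ≡ g (n % M)
periodic-% {M = M} {g = g} per n =
  trans (cong g (m≡m%n+[m/n]*n n M)) (periodic-+* per (n % M) (n / M))

%-periodic : ∀ {A : Set} {M} .{{_ : NonZero M}} {g : ℕ → A} → (∀ n → g n ≡ g (n % M)) → Periodic M g
%-periodic {M = M} {g = g} g≡g% n =
  trans (g≡g% (n + M)) (trans (cong g ([m+n]%n≡m%n n M)) (sym (g≡g% n)))

extend : (N : ℕ) .{{_ : NonZero N}} → (Fin N → ℕ) → ℕ → ℕ
extend N Δ n = Δ (fromℕ< (m%n<n n N))

extend-toℕ : ∀ N .{{_ : NonZero N}} Δ i → extend N Δ (toℕ i) ≡ Δ i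
extend-toℕ N Δ i = cong Δ (toℕ-injective (trans (toℕ-fromℕ< _) (m<n⇒m%n≡m (toℕ<n i))))

extend-periodic : ∀ N .{{_ : NonZero N}} Δ → Periodic N (extend N Δ)
extend-periodic N Δ n = cong Δ (toℕ-injective
  (trans (toℕ-fromℕ< _) (trans ([m+n]%n≡m%n n N) (sym (toℕ-fromℕ< _)))))

[m+kn]/n≡m/n+k : ∀ m k n .{{_ : NonZero n}} → (m + k * n) / n ≡ m / n + k
[m+kn]/n≡m/n+k m k n = trans (+-distrib-/-∣ʳ m (n∣m*n k)) (cong (_+_ (m / n)) (m*n/n≡m k n))

∸-suc-< : ∀ {k n} → k < n → n ∸ k ≡ suc (n ∸ suc k)
∸-suc-< {zero}  {suc n} _         = refl
∸-suc-< {suc k} {suc n} (s<s k<n) = ∸-suc-< k<n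

^-split : ∀ p {k n} → k ≤ n → p ^ n ≡ p ^ k * p ^ (n ∸ k)
^-split p {k} k≤n = trans (cong (p ^_) (sym (m+[n∸m]≡n k≤n))) (^-distribˡ-+-* p k _)

^-cancelˡ-≤ : ∀ {p m n} → 1 < p → p ^ m ≤ p ^ n → m ≤ n
^-cancelˡ-≤ {p} 1<p p^m≤p^n = ≮⇒≥ (λ n<m → <⇒≱ (^-monoʳ-< p 1<p n<m) p^m≤p^n)

≡-mod-p⇒≡ : ∀ {p x y} d → x < p → y < p → + x -ℤ + y ≡ + p *ℤ d → x ≡ y
≡-mod-p⇒≡ {p} {x} {y} d x<p y<p x-y≡pd =
  ℤP.+-injective (ℤP.i-j≡0⇒i≡j _ _ (trans x-y≡pd (trans (cong (+ p *ℤ_) d≡0) (ℤP.*-zeroʳ (+ p)))))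
  where
  p∣d∣<p*1 : p * ∣ d ∣ < p * 1
  p∣d∣<p*1 = begin-strict
    p * ∣ d ∣          ≡⟨ sym (ℤP.abs-* (+ p) d) ⟩
    ∣ + p *ℤ d ∣       ≡⟨ cong ∣_∣ (sym x-y≡pd) ⟩
    ∣ + x -ℤ + y ∣     ≡⟨ cong ∣_∣ (ℤP.[+m]-[+n]≡m⊖n x y) ⟩
    ∣ x ⊖ y ∣          ≤⟨ ℤP.∣m⊝n∣≤m⊔n x y ⟩
    Data.Nat._⊔_ x y   <⟨ ⊔-lub x<p y<p ⟩
    p                  ≡⟨ sym (*-identityʳ p) ⟩
    p * 1              ∎
    where open ≤-Reasoning
  d≡0 : d ≡ + 0
  d≡0 = ℤP.∣i∣≡0⇒i≡0 (n<1⇒n≡0 (*-cancelˡ-< p _ _ p∣d∣<p*1))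

scaled-≡-mod-p⇒≡ : ∀ {p c x y} .{{_ : NonZero c}} {A B K : ℤ} → x < p → y < p →
  + c *ℤ + x ≡ + c *ℤ (+ p *ℤ A) +ℤ K →
  + c *ℤ + y ≡ + c *ℤ (+ p *ℤ B) +ℤ K → x ≡ y
scaled-≡-mod-p⇒≡ {p} {c} {x} {y} {A} {B} {K} x<p y<p cx≡ cy≡ =
  ≡-mod-p⇒≡ (A -ℤ B) x<p y<p (ℤP.*-cancelˡ-≡ (+ c) _ _ (begin
    + c *ℤ (+ x -ℤ + y)                                      ≡⟨ distrib (+ c) (+ x) (+ y) ⟩
    + c *ℤ + x -ℤ + c *ℤ + y                                 ≡⟨ cong₂ _-ℤ_ cx≡ cy≡ ⟩
    (+ c *ℤ (+ p *ℤ A) +ℤ K) -ℤ (+ c *ℤ (+ p *ℤ B) +ℤ K)     ≡⟨ cancel (+ c) (+ p) A B K ⟩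
    + c *ℤ (+ p *ℤ (A -ℤ B))                                 ∎))
  where
  open ≡-Reasoning
  distrib : ∀ c x y → c *ℤ (x -ℤ y) ≡ c *ℤ x -ℤ c *ℤ y
  distrib = solve-∀
  cancel : ∀ c p A B K → (c *ℤ (p *ℤ A) +ℤ K) -ℤ (c *ℤ (p *ℤ B) +ℤ K) ≡ c *ℤ (p *ℤ (A -ℤ B))
  cancel = solve-∀

νp≤-^ : ∀ {p α j a} .{{_ : NonZero p}} → 1 < p → (p^j<p^α : p ^ j < p ^ α) → j ≤ a →
  νp≤ p α (fromℕ< p^j<p^α) a
νp≤-^ {p} {j = j} 1<p p^j<p^α j≤a i _ p^i∣z =
  ≤-trans (^-cancelˡ-≤ 1<p (∣⇒≤ {{m^n≢0 p j}} (subst (p ^ i ∣_) (toℕ-fromℕ< p^j<p^α) p^i∣z))) j≤a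

-- Lowering the period of Δ by one power of p

module Periodicity
  (p : ℕ) .{{_ : NonZero p}} (1<p : 1 < p) (α : ℕ) (Δ : Fin (p ^ α) → ℕ) (Δ<p : ∀ i → Δ i < p)
  where

  N : ℕ
  N = p ^ α

  instance
    N-nonZero : NonZero N
    N-nonZero = m^n≢0 p α

  D : ℕ → ℕ
  D = extend N Δ

  module Step (j : ℕ) (j<α : j < α) (z : Fin N) (z≡p^j : toℕ z ≡ p ^ j) where

    M Q P pʲ : ℕ
    M  = p ^ (α ∸ j)
    Q  = p ^ (α ∸ suc j)
    P  = p ^ (α ∸ 1)
    pʲ = p ^ j

    instance
      M-nonZero : NonZero M
      M-nonZero = m^n≢0 p (α ∸ j)
      Q-nonZero : NonZero Q
      Q-nonZero = m^n≢0 p (α ∸ suc j)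
      pʲ-nonZero : NonZero pʲ
      pʲ-nonZero = m^n≢0 p j

    M≡p*Q : M ≡ p * Q
    M≡p*Q = cong (p ^_) (∸-suc-< j<α)

    P≡pʲ*Q : P ≡ pʲ * Q
    P≡pʲ*Q = trans (^-split p (<⇒≤pred j<α)) (cong (λ e → pʲ * p ^ e) (∸-+-assoc α 1 j))

    N≡pʲ*M : N ≡ pʲ * M
    N≡pʲ*M = ^-split p (<⇒≤ j<α)

    -- χ r s is the indicator of the residue class s·Q + r modulo M = p·Q.
    χ : ℕ → ℕ → ℕ → ℤ
    χ r s m = δ (m % Q) r *ℤ δ (m / Q % p) s

    χ-+* : ∀ r s m t → χ r s (m + t * Q) ≡ δ (m % Q) r *ℤ δ ((m / Q + t) % p) s
    χ-+* r s m t =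
      cong₂ (λ u v → δ u r *ℤ δ (v % p) s) ([m+kn]%n≡m%n m t Q) ([m+kn]/n≡m/n+k m t Q)

    χ-periodic : ∀ r s → Periodic M (χ r s)
    χ-periodic r s n = begin
      χ r s (n + M)                         ≡⟨ cong (λ m → χ r s (n + m)) M≡p*Q ⟩
      χ r s (n + p * Q)                     ≡⟨ χ-+* r s n p ⟩
      δ (n % Q) r *ℤ δ ((n / Q + p) % p) s  ≡⟨ cong (λ u → δ (n % Q) r *ℤ δ u s)
                                                 ([m+n]%n≡m%n (n / Q) p) ⟩
      χ r s n                               ∎
      where open ≡-Reasoning

    χ-digits : ∀ r s {σ ρ} → σ < p → ρ < Q → χ r s (σ * Q + ρ) ≡ δ ρ r *ℤ δ σ s
    χ-digits r s {σ} {ρ} σ<p ρ<Q = begin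
      χ r s (σ * Q + ρ)                     ≡⟨ cong (χ r s) (+-comm (σ * Q) ρ) ⟩
      χ r s (ρ + σ * Q)                     ≡⟨ χ-+* r s ρ σ ⟩
      δ (ρ % Q) r *ℤ δ ((ρ / Q + σ) % p) s  ≡⟨ cong₂ (λ u v → δ u r *ℤ δ (v % p) s)
                                                 (m<n⇒m%n≡m ρ<Q) (cong (_+ σ) (m<n⇒m/n≡0 ρ<Q)) ⟩
      δ ρ r *ℤ δ (σ % p) s                  ≡⟨ cong (λ v → δ ρ r *ℤ δ v s) (m<n⇒m%n≡m σ<p) ⟩
      δ ρ r *ℤ δ σ s                        ∎
      where open ≡-Reasoning

    ∑-χ : ∀ {r s} (f : ℕ → ℤ) → r < Q → s < p → ∑ M (λ n → χ r s n *ℤ f n) ≡ f (s * Q + r)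
    ∑-χ {r} {s} f r<Q s<p = begin
      ∑ M (λ n → χ r s n *ℤ f n)
        ≡⟨ cong (λ m → ∑ m (λ n → χ r s n *ℤ f n)) M≡p*Q ⟩
      ∑ (p * Q) (λ n → χ r s n *ℤ f n)
        ≡⟨ ∑-* p Q (λ n → χ r s n *ℤ f n) ⟩
      ∑ p (λ σ → ∑ Q (λ ρ → χ r s (σ * Q + ρ) *ℤ f (σ * Q + ρ)))
        ≡⟨ ∑-cong p (λ σ σ<p → ∑-cong Q (λ ρ ρ<Q →
             trans (cong (_*ℤ f (σ * Q + ρ)) (χ-digits r s σ<p ρ<Q))
                   (ℤP.*-assoc (δ ρ r) (δ σ s) _))) ⟩
      ∑ p (λ σ → ∑ Q (λ ρ → δ ρ r *ℤ (δ σ s *ℤ f (σ * Q + ρ))))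
        ≡⟨ ∑-cong p (λ σ _ → ∑-δ Q (λ ρ → δ σ s *ℤ f (σ * Q + ρ)) r<Q) ⟩
      ∑ p (λ σ → δ σ s *ℤ f (σ * Q + r))
        ≡⟨ ∑-δ p (λ σ → f (σ * Q + r)) s<p ⟩
      f (s * Q + r)
        ∎
      where open ≡-Reasoning

    test : ℕ → ℕ → ℕ → ℤ
    test r s k = δ (k % pʲ) 0 *ℤ χ r s (k / pʲ)

    test-*pʲ : ∀ r s m → test r s (m * pʲ) ≡ χ r s m
    test-*pʲ r s m =
      trans (cong₂ (λ u v → δ u 0 *ℤ χ r s v) (m*n%n≡0 m pʲ) (m*n/n≡m m pʲ)) (ℤP.*-identityˡ _)

    test-fourier : Periodic M D → ∀ {r s} → r < Q → s < p →
      ⟪ test r s , fourier p α Δ z ⟫ ≡ + pʲ *ℤ + D (s * Q + r)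
    test-fourier D-periodic {r} {s} r<Q s<p = begin
      ⟪ test r s , fourier p α Δ z ⟫
        ≡⟨ ⟪⟫-∑monomial (test r s) (λ i → + Δ i) (λ i → toℕ i * toℕ z) (allFin N) ⟩
      foldr (λ i acc → test r s (toℕ i * toℕ z) *ℤ + Δ i +ℤ acc) (+ 0) (allFin N)
        ≡⟨ ∑-tabulate N (λ i → i) (λ i → test r s (toℕ i * toℕ z) *ℤ + Δ i) g (λ i → cong₂ _*ℤ_
             (trans (cong (λ u → test r s (toℕ i * u)) z≡p^j) (test-*pʲ r s (toℕ i)))
             (cong +_ (sym (extend-toℕ N Δ i)))) ⟩
      ∑ N g                    ≡⟨ cong (λ m → ∑ m g) N≡pʲ*M ⟩
      ∑ (pʲ * M) g             ≡⟨ ∑-periodic M g-periodic pʲ ⟩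
      + pʲ *ℤ ∑ M g            ≡⟨ cong (+ pʲ *ℤ_) (∑-χ (λ n → + D n) r<Q s<p) ⟩
      + pʲ *ℤ + D (s * Q + r)  ∎
      where
      open ≡-Reasoning
      g : ℕ → ℤ
      g n = χ r s n *ℤ + D n
      g-periodic : Periodic M g
      g-periodic n = cong₂ _*ℤ_ (χ-periodic r s n) (cong +_ (D-periodic n))

    Φ-weight : ℕ → ℕ → ℤ
    Φ-weight r n = δ (n % pʲ) 0 *ℤ δ (n / pʲ % Q) r

    test-fibre : ∀ r {s} → s < p → ∀ n → ∑ p (λ t → test r s (n + t * P)) ≡ Φ-weight r n
    test-fibre r {s} s<p n = begin
      ∑ p (λ t → test r s (n + t * P))
        ≡⟨ ∑-cong p (λ t _ → cong (λ m → test r s (n + m)) (t*P≡t*Q*pʲ t)) ⟩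
      ∑ p (λ t → test r s (n + t * Q * pʲ))
        ≡⟨ ∑-cong p (λ t _ → cong₂ (λ u v → δ u 0 *ℤ χ r s v)
             ([m+kn]%n≡m%n n (t * Q) pʲ) ([m+kn]/n≡m/n+k n (t * Q) pʲ)) ⟩
      ∑ p (λ t → δ (n % pʲ) 0 *ℤ χ r s (n / pʲ + t * Q))
        ≡⟨ ∑-*ˡ p (δ (n % pʲ) 0) (λ t → χ r s (n / pʲ + t * Q)) ⟩
      δ (n % pʲ) 0 *ℤ ∑ p (λ t → χ r s (n / pʲ + t * Q))
        ≡⟨ cong (δ (n % pʲ) 0 *ℤ_) (trans (∑-cong p (λ t _ → χ-+* r s (n / pʲ) t))
             (∑-*ˡ p (δ (n / pʲ % Q) r) (λ t → δ ((n / pʲ / Q + t) % p) s))) ⟩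
      δ (n % pʲ) 0 *ℤ (δ (n / pʲ % Q) r *ℤ ∑ p (λ t → δ ((n / pʲ / Q + t) % p) s))
        ≡⟨ cong (λ u → δ (n % pʲ) 0 *ℤ (δ (n / pʲ % Q) r *ℤ u)) (∑-δ-% p s<p (n / pʲ / Q)) ⟩
      δ (n % pʲ) 0 *ℤ (δ (n / pʲ % Q) r *ℤ + 1)
        ≡⟨ cong (δ (n % pʲ) 0 *ℤ_) (ℤP.*-identityʳ _) ⟩
      Φ-weight r n
        ∎
      where
      open ≡-Reasoning
      t*P≡t*Q*pʲ : ∀ t → t * P ≡ t * Q * pʲ
      t*P≡t*Q*pʲ t = trans (cong (t *_) (trans P≡pʲ*Q (*-comm pʲ Q))) (sym (*-assoc t Q pʲ))

    test-Φ⊛ : ∀ r {s} → s < p → ∀ h → ⟪ test r s , cyclotomicPP p α ⊛ h ⟫ ≡ ⟪ Φ-weight r , h ⟫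
    test-Φ⊛ r {s} s<p h = trans (⟪⟫-cyclotomic⊛ p α (test r s) h) (⟪⟫-congˡ (test-fibre r s<p) h)

    digit-independent : Periodic M D →
      ∀ {e} → DividesInℤζ p α (+ (p ^ suc j * e)) (fourier p α Δ z) →
      ∀ {r s} → r < Q → s < p → D (s * Q + r) ≡ D r
    digit-independent D-periodic {e} (g , h , F≈) {r} r<Q s<p =
      scaled-≡-mod-p⇒≡ {c = pʲ} (Δ<p _) (Δ<p _) (reading s<p) (reading (>-nonZero⁻¹ p))
      where
      open ≡-Reasoning
      reassoc : ∀ a b c x → a *ℤ b *ℤ c *ℤ x ≡ b *ℤ (a *ℤ (c *ℤ x))
      reassoc = solve-∀
      regroup : ∀ G → + (p ^ suc j * e) *ℤ G ≡ + pʲ *ℤ (+ p *ℤ (+ e *ℤ G))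
      regroup G = trans
        (cong (_*ℤ G) (trans (ℤP.pos-* (p * pʲ) e) (cong (_*ℤ + e) (ℤP.pos-* p pʲ))))
        (reassoc (+ p) (+ pʲ) (+ e) G)
      reading : ∀ {s} → s < p → + pʲ *ℤ + D (s * Q + r) ≡
        + pʲ *ℤ (+ p *ℤ (+ e *ℤ ⟪ test r s , g ⟫)) +ℤ ⟪ Φ-weight r , h ⟫
      reading {s} s<p = begin
        + pʲ *ℤ + D (s * Q + r)
          ≡⟨ sym (test-fourier D-periodic r<Q s<p) ⟩
        ⟪ test r s , fourier p α Δ z ⟫
          ≡⟨ ⟪⟫-≈ (test r s) (fourier p α Δ z)
               (const (+ (p ^ suc j * e)) ⊛ g ⊕ cyclotomicPP p α ⊛ h) F≈ ⟩
        ⟪ test r s , const (+ (p ^ suc j * e)) ⊛ g ⊕ cyclotomicPP p α ⊛ h ⟫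
          ≡⟨ ⟪⟫-⊕ (test r s) (const (+ (p ^ suc j * e)) ⊛ g) _ ⟩
        ⟪ test r s , const (+ (p ^ suc j * e)) ⊛ g ⟫ +ℤ ⟪ test r s , cyclotomicPP p α ⊛ h ⟫
          ≡⟨ cong₂ _+ℤ_ (trans (⟪⟫-const⊛ (test r s) (+ (p ^ suc j * e)) g) (regroup _))
               (test-Φ⊛ r s<p h) ⟩
        + pʲ *ℤ (+ p *ℤ (+ e *ℤ ⟪ test r s , g ⟫)) +ℤ ⟪ Φ-weight r , h ⟫
          ∎

    period-descends : Periodic M D →
      ∀ {e} → DividesInℤζ p α (+ (p ^ suc j * e)) (fourier p α Δ z) → Periodic Q D
    period-descends D-periodic divides = %-periodic λ n → begin
      D n                        ≡⟨ periodic-% D-periodic n ⟩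
      D (n % M)                  ≡⟨ cong D (digits n) ⟩
      D (n % M / Q * Q + n % Q)  ≡⟨ digit-independent D-periodic divides (m%n<n n Q)
                                      (m<n*o⇒m/o<n (subst (n % M <_) M≡p*Q (m%n<n n M))) ⟩
      D (n % Q)                  ∎
      where
      open ≡-Reasoning
      Q∣M : Q ∣ M
      Q∣M = subst (Q ∣_) (sym M≡p*Q) (n∣m*n p)
      digits : ∀ n → n % M ≡ n % M / Q * Q + n % Q
      digits n = trans (m≡m%n+[m/n]*n (n % M) Q)
        (trans (+-comm (n % M % Q) _) (cong (λ u → n % M / Q * Q + u) (m∣n⇒o%n%m≡o%m Q M n Q∣M)))

  D-periodic-p^[α∸j] : ∀ a → a < α →
    (∀ z → νp≤ p α z a → DividesInℤζ p α (+ (p ^ a)) (fourier p α Δ z)) →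
    ∀ j → j ≤ a → Periodic (p ^ (α ∸ j)) D
  D-periodic-p^[α∸j] a a<α divides zero    _   = extend-periodic N Δ
  D-periodic-p^[α∸j] a a<α divides (suc j) j<a =
    Step.period-descends j j<α z (toℕ-fromℕ< p^j<p^α) (D-periodic-p^[α∸j] a a<α divides j (<⇒≤ j<a))
      (subst (λ m → DividesInℤζ p α (+ m) (fourier p α Δ z)) (^-split p j<a)
        (divides z (νp≤-^ 1<p p^j<p^α (<⇒≤ j<a))))
    where
    j<α : j < α
    j<α = <-trans j<a a<α
    p^j<p^α : p ^ j < p ^ α
    p^j<p^α = ^-monoʳ-< p 1<p j<α
    z : Fin N
    z = fromℕ< p^j<p^α

lemma3p6 : (p : ℕ) (pr : Prime p) (α : ℕ) → 1 ≤ α →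
    (Δ : Fin (p ^ α) → ℕ) → (∀ i → Δ i ≤ p ∸ 1) →
    (a : ℕ) → a ≤ α ∸ 1 →
    (∀ z → νp≤ p α z a → DividesInℤζ p α (+ (p ^ a)) (fourier p α Δ z)) →
    Σ (Fin (p ^ (α ∸ a)) → ℕ) λ S → ∀ i → Δ i ≡ S (ψ p pr α (α ∸ a) i)
lemma3p6 p pr α 1≤α Δ Δ≤p-1 a a≤α-1 divides = S , λ i → begin
  Δ i                        ≡⟨ sym (extend-toℕ N Δ i) ⟩
  D (toℕ i)                  ≡⟨ periodic-% (D-periodic-p^[α∸j] a a<α divides a ≤-refl) (toℕ i) ⟩
  D (toℕ i % p ^ (α ∸ a))    ≡⟨ cong D (sym (toℕ-fromℕ< _)) ⟩
  S (ψ p pr α (α ∸ a) i)     ∎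
  where
  open ≡-Reasoning
  instance
    p-nonZero : NonZero p
    p-nonZero = prime⇒nonZero pr
    p^[α∸a]-nonZero : NonZero (p ^ (α ∸ a))
    p^[α∸a]-nonZero = m^n≢0 p (α ∸ a)
  open Periodicity p (nonTrivial⇒n>1 p {{prime⇒nonTrivial pr}}) α Δ (m≤pred[n]⇒suc[m]≤n ∘ Δ≤p-1)
  a<α : a < α
  a<α = m≤pred[n]⇒suc[m]≤n {{>-nonZero 1≤α}} a≤α-1
  S : Fin (p ^ (α ∸ a)) → ℕ
  S y = D (toℕ y)
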